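{- Let $M=(ST,AC,out_{AG},L)$ be a grand-coalition-first action model. The following three conditions are equivalent: (1) there is $r\in ST$ such that for every $a\in AG$ and $s\in ST$, there is a unique $\{a\}$-history from $r$ to $s$; (2) there is $r\in ST$ such that for every $C\subseteq AG$ and $s\in ST$, there is a unique $C$-history from $r$ to $s$; (3) there is $r\in ST$ such that for every $s\in ST$, there is a unique $AG$-history from $r$ to $s$.
   Context: $AG$ is a finite nonempty set of agents, $AP$ a countable set of atomic propositions. For a nonempty set $AC$ and $C\subseteq AG$, $JA_C$ is the set of functions $\sigma_C:C\to AC$ ($JA_\emptyset=\{\emptyset\}$); $\sigma_C\subseteq\sigma_{AG}$ means $\sigma_C$ is the restriction of $\sigma_{AG}$ to $C$. A grand-coalition-first action model is $(ST,AC,out_{AG},L)$ with $ST,AC$ nonempty, $out_{AG}:ST\times JA_{AG}\to\mathcal P(ST)$, $L:ST\to\mathcal P(AP)$. It determines $out_C(s,\sigma_C)=\bigcup\{out_{AG}(s,\sigma_{AG})\mid\sigma_C\subseteq\sigma_{AG}\}$ and $av_C(s)=\{\sigma_C\in JA_C\mid out_C(s,\sigma_C)\neq\emptyset\}$. For $C\subseteq AG$, a $C$-history from $s_0$ to $s_n$ is either the one-element sequence $(s_0)$ (a $C$-history from $s_0$ to $s_0$) or a finite sequence $(s_0,\sigma^1_C,s_1,\dots,\sigma^n_C,s_n)$, $n\ge1$, of states $s_i$ and joint actions $\sigma^i_C\in JA_C$ such that for every $0\le i<n$, $\sigma^{i+1}_C\in av_C(s_i)$ and $s_{i+1}\in out_C(s_i,\sigma^{i+1}_C)$.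 -}

module Defs where

open import Data.Nat using (ℕ; suc)
open import Data.Fin using (Fin)
open import Data.Fin.Subset using (Subset; _∈_; ⊤; ⁅_⁆)
open import Data.Product using (Σ; ∃; _×_; _,_)
open import Data.List using (List; []; _∷_)
open import Data.List.Relation.Binary.Pointwise using (Pointwise)
open import Data.Unit using () renaming (⊤ to Unit)
open import Relation.Binary.PropositionalEquality using (_≡_)

-- Agents: AG = Fin n (finite). Coalitions C ⊆ AG: Subset n.
-- Atomic propositions: AP = ℕ (a countable set).
AP : Set
AP = ℕ

JA : {n : ℕ} → Set → Subset n → Set
JA {n} AC C = (i : Fin n) → i ∈ C → AC

_⊑_ : {n : ℕ} {AC : Set} {C : Subset n} → JA AC C → JA AC ⊤ → Set
_⊑_ {n} {AC} {C} σC σAG = (i : Fin n) (p : i ∈ C) (q : i ∈ ⊤) → σC i p ≡ σAG i q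

_≈JA_ : {n : ℕ} {AC : Set} {C : Subset n} → JA AC C → JA AC C → Set
_≈JA_ {n} {C = C} σ τ = (i : Fin n) (p : i ∈ C) → σ i p ≡ τ i p

-- Grand-coalition-first action model; subsets of ST are predicates ST → Set.
record ActionModel (n : ℕ) : Set₁ where
  field
    ST     : Set
    AC     : Set
    st₀    : ST          -- ST nonempty
    ac₀    : AC          -- AC nonempty
    outAG  : ST → JA AC ⊤ → ST → Set    -- outAG s σ t  :  t ∈ out_AG(s, σ)
    L      : ST → AP → Set               -- L s p  :  p ∈ L(s)

  out : (C : Subset n) → ST → JA AC C → ST → Set
  out C s σC t = Σ (JA AC ⊤) λ σAG → (σC ⊑ σAG) × outAG s σAG t

  av : (C : Subset n) → ST → JA AC C → Set
  av C s σC = ∃ λ t → out C s σC t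

  -- A C-history (s₀, σ¹, s₁, …, σᵐ, sₘ) is represented by its start s₀
  -- together with the list of steps ((σ¹, s₁), …, (σᵐ, sₘ)); m = 0 gives (s₀).
  Steps : Subset n → Set
  Steps C = List (JA AC C × ST)

  Valid : (C : Subset n) → ST → Steps C → Set
  Valid C s [] = Unit
  Valid C s ((σ , t) ∷ ws) = av C s σ × out C s σ t × Valid C t ws

  last : {C : Subset n} → ST → Steps C → ST
  last s [] = s
  last s ((σ , t) ∷ ws) = last t ws

  IsHistory : (C : Subset n) → ST → ST → Steps C → Set
  IsHistory C r s ws = Valid C r ws × last r ws ≡ s

  _≈H_ : {C : Subset n} → Steps C → Steps C → Set
  _≈H_ = Pointwise (λ x y → (Data.Product.proj₁ x ≈JA Data.Product.proj₁ y)
                             × (Data.Product.proj₂ x ≡ Data.Product.proj₂ y))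

  UniqueHistory : (C : Subset n) → ST → ST → Set
  UniqueHistory C r s =
    Σ (Steps C) λ h → IsHistory C r s h × ((h' : Steps C) → IsHistory C r s h' → h' ≈H h)

  Cond1 : Set
  Cond1 = Σ ST λ r → (a : Fin n) (s : ST) → UniqueHistory ⁅ a ⁆ r s

  Cond2 : Set
  Cond2 = Σ ST λ r → (C : Subset n) (s : ST) → UniqueHistory C r s

  Cond3 : Set
  Cond3 = Σ ST λ r → (s : ST) → UniqueHistory ⊤ r s

{-# OPTIONS --safe #-}
module Submission where

open import Defs
open import Data.Nat using (ℕ; suc)
open import Data.Fin using (Fin; zero)
open import Data.Fin.Subset using (Subset; ⊤; ⁅_⁆)
open import Data.Fin.Subset.Properties using (∈⊤; x∈⁅x⁆)
open import Data.Vec.Properties.WithK using ([]=-irrelevant)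
open import Data.Product using (Σ; _×_; _,_; proj₁; proj₂; map₁)
open import Data.List using ([]; _∷_; map)
open import Data.List.Relation.Binary.Pointwise using ([]; _∷_; head; tail; map⁺)
  renaming (map to pointwise-map)
open import Data.List.Relation.Binary.Pointwise.Properties using (symmetric; transitive)
open import Relation.Binary.PropositionalEquality using (refl; sym; trans; cong)

-- A C-history is the restriction of an AG-history (pick, at every step, a grand-coalition
-- action witnessing the C-outcome), and restriction preserves histories. Hence uniqueness
-- of AG-histories passes to every coalition C. Conversely, an AG-history is determined by
-- its restrictions to the singletons {a}, since a grand-coalition action is determined by
-- the actions of the individual agents; so unique {a}-histories force a unique AG-history.

module Histories {n : ℕ} (M : ActionModel n) where
  open ActionModel M

  ≈H-sym : {C : Subset n} {g h : Steps C} → g ≈H h → h ≈H g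
  ≈H-sym = symmetric λ (σ≈τ , s≡t) → (λ i p → sym (σ≈τ i p)) , sym s≡t

  ≈H-trans : {C : Subset n} {g h k : Steps C} → g ≈H h → h ≈H k → g ≈H k
  ≈H-trans = transitive λ (σ≈τ , s≡t) (τ≈υ , t≡u) →
    (λ i p → trans (σ≈τ i p) (τ≈υ i p)) , trans s≡t t≡u

  restrictJA : (C : Subset n) → JA AC ⊤ → JA AC C
  restrictJA C σ i _ = σ i ∈⊤

  restrict : (C : Subset n) → Steps ⊤ → Steps C
  restrict C = map (map₁ (restrictJA C))

  restrict-cong : (C : Subset n) {g h : Steps ⊤} → g ≈H h → restrict C g ≈H restrict C h
  restrict-cong C g≈h = map⁺ _ _ (pointwise-map (λ (σ≈τ , s≡t) → (λ i _ → σ≈τ i ∈⊤) , s≡t) g≈h)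

  outAG⇒out⊤ : {s t : ST} {σ : JA AC ⊤} → outAG s σ t → out ⊤ s σ t
  outAG⇒out⊤ {σ = σ} o = σ , (λ i p q → cong (σ i) ([]=-irrelevant p q)) , o

  out-restrict : (C : Subset n) {s t : ST} {σ : JA AC ⊤} →
                 out ⊤ s σ t → out C s (restrictJA C σ) t
  out-restrict C (σAG , σ⊑σAG , o) = σAG , (λ i _ q → σ⊑σAG i ∈⊤ q) , o

  history-∷ : {C : Subset n} {r s t : ST} {σ : JA AC C} {ws : Steps C} →
              out C r σ t → IsHistory C t s ws → IsHistory C r s ((σ , t) ∷ ws)
  history-∷ o (v , l) = ((_ , o) , o , v) , l

  restrict-history : (C : Subset n) {r s : ST} (g : Steps ⊤) →
                     IsHistory ⊤ r s g → IsHistory C r s (restrict C g)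
  restrict-history C [] h = h
  restrict-history C (_ ∷ g) ((_ , o , v) , l) =
    history-∷ (out-restrict C o) (restrict-history C g (v , l))

  lift-history : (C : Subset n) {r s : ST} (ws : Steps C) → IsHistory C r s ws →
                 Σ (Steps ⊤) λ g → IsHistory ⊤ r s g × ws ≈H restrict C g
  lift-history C [] h = [] , h , []
  lift-history C ((σ , t) ∷ ws) ((_ , (σAG , σ⊑σAG , o) , v) , l)
    with g , hg , ws≈g ← lift-history C ws (v , l) =
    (σAG , t) ∷ g , history-∷ (outAG⇒out⊤ o) hg , ((λ i p → σ⊑σAG i p ∈⊤) , refl) ∷ ws≈g

  unique-≈H : {C : Subset n} {r s : ST} {g h : Steps C} →
              UniqueHistory C r s → IsHistory C r s g → IsHistory C r s h → g ≈H h
  unique-≈H (_ , _ , unique) hg hh = ≈H-trans (unique _ hg) (≈H-sym (unique _ hh))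

  uniqueHistory-restrict : (C : Subset n) {r s : ST} → UniqueHistory ⊤ r s → UniqueHistory C r s
  uniqueHistory-restrict C (g , hg , unique) =
    restrict C g , restrict-history C g hg , λ ws hws →
      let g′ , hg′ , ws≈g′ = lift-history C ws hws
      in ≈H-trans ws≈g′ (restrict-cong C (unique g′ hg′))

  restrict-⁅⁆-injective : Fin n → (g h : Steps ⊤) →
                          (∀ a → restrict ⁅ a ⁆ g ≈H restrict ⁅ a ⁆ h) → g ≈H h
  restrict-⁅⁆-injective a₀ [] [] _ = []
  restrict-⁅⁆-injective a₀ [] (_ ∷ _) g≈h with () ← g≈h a₀
  restrict-⁅⁆-injective a₀ (_ ∷ _) [] g≈h with () ← g≈h a₀
  restrict-⁅⁆-injective a₀ ((σ , _) ∷ g) ((τ , _) ∷ h) g≈h =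
    (σ≈τ , proj₂ (head (g≈h a₀))) ∷ restrict-⁅⁆-injective a₀ g h (λ a → tail (g≈h a))
    where
    σ≈τ : σ ≈JA τ
    σ≈τ i p rewrite []=-irrelevant p ∈⊤ = proj₁ (head (g≈h i)) i (x∈⁅x⁆ i)

  uniqueHistory-from-singletons : Fin n → {r s : ST} →
                                  (∀ a → UniqueHistory ⁅ a ⁆ r s) → UniqueHistory ⊤ r s
  uniqueHistory-from-singletons a₀ unique
    with h₀ , hh₀ , _ ← unique a₀
    with g , hg , _ ← lift-history ⁅ a₀ ⁆ h₀ hh₀ =
    g , hg , λ g′ hg′ → restrict-⁅⁆-injective a₀ g′ g λ a →
      unique-≈H (unique a) (restrict-history ⁅ a ⁆ g′ hg′) (restrict-history ⁅ a ⁆ g hg)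

theorem6p3 : (k : ℕ) (M : ActionModel (suc k)) →
    let open ActionModel M in
    (Cond1 → Cond2) × (Cond2 → Cond3) × (Cond3 → Cond1)
theorem6p3 k M =
    (λ (r , unique) → r , λ C s →
       uniqueHistory-restrict C (uniqueHistory-from-singletons zero λ a → unique a s))
  , (λ (r , unique) → r , unique ⊤)
  , (λ (r , unique) → r , λ a s → uniqueHistory-restrict ⁅ a ⁆ (unique s))
  where open Histories M
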